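{- Let $n\geq 4$ and let $\overline{C_n}$ be the complement of the cycle $C_n$. Then \[ \gamma^{r}(\overline{C_n})=\begin{cases} 4 & \text{if } n=4,\\ 3 & \text{if } n=5,\\ 2 & \text{otherwise.}\end{cases} \]
   Context: All graphs are finite, simple and undirected. For a graph $G=(V,E)$, a set $S\subseteq V$ is a restrained dominating set if every vertex of $V-S$ is adjacent to at least one vertex of $S$ and to at least one vertex of $V-S$. The restrained domination number $\gamma^{r}(G)$ is the minimum cardinality of a restrained dominating set of $G$. The complement $\overline{G}$ of $G$ has vertex set $V$, two distinct vertices being adjacent in $\overline{G}$ iff they are non-adjacent in $G$. -}

module Defs where

open import Data.Nat using (ℕ; suc; _≤_)
open import Data.Fin using (Fin; toℕ)
open import Data.Fin.Subset using (Subset; _∈_; _∉_; ∣_∣)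
open import Data.Product using (Σ; _×_; ∃; _,_)
open import Data.Sum using (_⊎_)
open import Relation.Nullary using (¬_)
open import Relation.Binary.PropositionalEquality using (_≡_)

Graph : ℕ → Set₁
Graph n = Fin n → Fin n → Set

complement : ∀ {n} → Graph n → Graph n
complement G u v = ¬ (u ≡ v) × ¬ G u v

cycSucc : ∀ {n} → Fin n → Fin n → Set
cycSucc {n} i j = (suc (toℕ i) ≡ toℕ j) ⊎ (suc (toℕ i) ≡ n × toℕ j ≡ 0)

cycle : (n : ℕ) → Graph n
cycle n i j = cycSucc i j ⊎ cycSucc j i

IsRestrainedDominating : ∀ {n} → Graph n → Subset n → Set
IsRestrainedDominating {n} G S =
  (v : Fin n) → v ∉ S →
    (∃ λ u → u ∈ S × G v u) × (∃ λ w → w ∉ S × G v w)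

RestrainedDominationNumber : ∀ {n} → Graph n → ℕ → Set
RestrainedDominationNumber {n} G k =
  (Σ (Subset n) λ S → IsRestrainedDominating G S × ∣ S ∣ ≡ k)
  × ((S : Subset n) → IsRestrainedDominating G S → k ≤ ∣ S ∣)

-- Every vertex v of the complement of Cₙ misses its cycle successor, so a
-- restrained dominating set containing v must contain a second vertex: either
-- that successor, or (if it lies outside) one of its neighbours, which is not v.
-- Hence γʳ ≥ 2, and for n ≥ 6 the set {0, 1} attains it: every other vertex is
-- adjacent to 0 or 1, and there are enough vertices outside {0, 1} to give each
-- of them a neighbour outside. The cases n = 4 and n = 5 are settled by
-- exhaustive search over all subsets.
module Submission where

open import Defs
open import Data.Fin using (Fin; zero; suc; toℕ; fromℕ<; _≟_; #_)
open import Data.Fin.Properties using (any?; all?; toℕ-fromℕ<; toℕ<n)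
open import Data.Fin.Subset using (Subset; _∈_; _∉_; ∣_∣; ⊥; ⊤; inside; outside; Nonempty)
open import Data.Fin.Subset.Properties using (_∈?_; ∣p∣≤∣x∷p∣; ∉⊥; ∣⊥∣≡0; anySubset?)
open import Data.Nat as ℕ using (ℕ; _+_; _≤_; _<_; _≥_; _≤?_; z≤n; s≤s)
import Data.Nat.Properties as ℕ
open import Data.Product using (∃; _×_; _,_; proj₁)
open import Data.Sum using (_⊎_; inj₁; inj₂; [_,_])
open import Data.Vec using ([]; _∷_; here; there)
open import Function using (_∘_)
open import Relation.Binary.Definitions using (Decidable; Symmetric)
open import Relation.Binary.PropositionalEquality using (_≡_; _≢_; refl; sym; trans; cong; subst)
open import Relation.Nullary using (¬_; Dec; yes; no; ¬?; contradiction)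
open import Relation.Nullary.Decidable using (_×-dec_; _⊎-dec_; _→-dec_; from-yes; decidable-stable)
import Relation.Nullary.Decidable as Dec

private
  variable
    n : ℕ
    S : Subset n

x∈p⇒0<∣p∣ : {p : Subset n} {x : Fin n} → x ∈ p → 0 < ∣ p ∣
x∈p⇒0<∣p∣ {p = inside ∷ _} here = s≤s z≤n
x∈p⇒0<∣p∣ {p = b ∷ p} (there x∈p) = ℕ.≤-trans (x∈p⇒0<∣p∣ x∈p) (∣p∣≤∣x∷p∣ b p)

x≢y⇒x∈p⇒y∈p⇒1<∣p∣ : {p : Subset n} {x y : Fin n} → x ≢ y → x ∈ p → y ∈ p → 1 < ∣ p ∣
x≢y⇒x∈p⇒y∈p⇒1<∣p∣ x≢y here here = contradiction refl x≢y
x≢y⇒x∈p⇒y∈p⇒1<∣p∣ x≢y here (there y∈p) = s≤s (x∈p⇒0<∣p∣ y∈p)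
x≢y⇒x∈p⇒y∈p⇒1<∣p∣ x≢y (there x∈p) here = s≤s (x∈p⇒0<∣p∣ x∈p)
x≢y⇒x∈p⇒y∈p⇒1<∣p∣ {p = b ∷ p} x≢y (there x∈p) (there y∈p) =
  ℕ.≤-trans (x≢y⇒x∈p⇒y∈p⇒1<∣p∣ (x≢y ∘ cong suc) x∈p y∈p) (∣p∣≤∣x∷p∣ b p)

allSubset? : {P : Subset n → Set} → (∀ p → Dec (P p)) → Dec (∀ p → P p)
allSubset? P? = Dec.map′
  (λ ¬∃¬P p → decidable-stable (P? p) (λ ¬Pp → ¬∃¬P (p , ¬Pp)))
  (λ ∀P (p , ¬Pp) → ¬Pp (∀P p))
  (¬? (anySubset? (¬? ∘ P?)))

module _ {G : Graph n} where

  restrainedDominating-nonempty : IsRestrainedDominating G S → Fin n → Nonempty S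
  restrainedDominating-nonempty {S = S} rds v with v ∈? S
  ... | yes v∈S = v , v∈S
  ... | no  v∉S = let u , u∈S , _ = proj₁ (rds v v∉S) in u , u∈S

  restrainedDominating-≥2 : (∀ x → ∃ λ y → y ≢ x × ¬ G y x) →
                            IsRestrainedDominating G S → Fin n → 2 ≤ ∣ S ∣
  restrainedDominating-≥2 {S = S} nonNeighbour rds v
    with x , x∈S ← restrainedDominating-nonempty rds v
    with y , y≢x , ¬Gyx ← nonNeighbour x
    with y ∈? S
  ... | yes y∈S = x≢y⇒x∈p⇒y∈p⇒1<∣p∣ (y≢x ∘ sym) x∈S y∈S
  ... | no  y∉S = let w , w∈S , Gyw = proj₁ (rds y y∉S) in
    x≢y⇒x∈p⇒y∈p⇒1<∣p∣ (λ { refl → ¬Gyx Gyw }) x∈S w∈S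

complement? : {G : Graph n} → Decidable G → Decidable (complement G)
complement? G? u v = ¬? (u ≟ v) ×-dec ¬? (G? u v)

complement-sym : {G : Graph n} → Symmetric G → Symmetric (complement G)
complement-sym G-sym (u≢v , ¬Guv) = u≢v ∘ sym , ¬Guv ∘ G-sym

isRestrainedDominating? : {G : Graph n} → Decidable G → ∀ S → Dec (IsRestrainedDominating G S)
isRestrainedDominating? G? S = all? λ v → ¬? (v ∈? S) →-dec
  (any? (λ u → (u ∈? S) ×-dec G? v u) ×-dec any? (λ w → ¬? (w ∈? S) ×-dec G? v w))

isRestrainedLowerBound? : {G : Graph n} → Decidable G → ∀ k →
                          Dec ((S : Subset n) → IsRestrainedDominating G S → k ≤ ∣ S ∣)
isRestrainedLowerBound? G? k = allSubset? λ S → isRestrainedDominating? G? S →-dec (k ≤? ∣ S ∣)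

cycSucc? : Decidable (cycSucc {n})
cycSucc? {n} i j = (ℕ.suc (toℕ i) ℕ.≟ toℕ j) ⊎-dec ((ℕ.suc (toℕ i) ℕ.≟ n) ×-dec (toℕ j ℕ.≟ 0))

cycle? : ∀ n → Decidable (cycle n)
cycle? _ i j = cycSucc? i j ⊎-dec cycSucc? j i

cycle-sym : Symmetric (cycle n)
cycle-sym (inj₁ c) = inj₂ c
cycle-sym (inj₂ c) = inj₁ c

complement-cycle-sym : Symmetric (complement (cycle n))
complement-cycle-sym = complement-sym cycle-sym

cycSucc-total : (x : Fin (ℕ.suc n)) → ∃ (cycSucc x)
cycSucc-total {n} x with ℕ.suc (toℕ x) ℕ.<? ℕ.suc n
... | yes x+1<n = fromℕ< x+1<n , inj₁ (sym (toℕ-fromℕ< x+1<n))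
... | no  x+1≮n = zero , inj₂ (ℕ.≤-antisym (toℕ<n x) (ℕ.≮⇒≥ x+1≮n) , refl)

cycSucc-irrefl : {x : Fin (2 + n)} → ¬ cycSucc x x
cycSucc-irrefl (inj₁ x+1≡x) = ℕ.1+n≢n x+1≡x
cycSucc-irrefl (inj₂ (x+1≡n , x≡0)) with trans (cong ℕ.suc (sym x≡0)) x+1≡n
... | ()

complement-cycle-nonNeighbour : (x : Fin (2 + n)) → ∃ λ y → y ≢ x × ¬ complement (cycle (2 + n)) y x
complement-cycle-nonNeighbour x =
  let y , x→y = cycSucc-total x in
  y , (λ y≡x → cycSucc-irrefl (subst (cycSucc x) y≡x x→y)) , λ (_ , ¬cycle) → ¬cycle (inj₂ x→y)

-- The second hypothesis excludes the wrap-around edge {0, n - 1}.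
apart⇒adjacent : {i j : Fin n} → 2 + toℕ i ≤ toℕ j → 0 < toℕ i ⊎ 1 + toℕ j < n →
                 complement (cycle n) j i
apart⇒adjacent {i = i} {j} i+2≤j end = j≢i , λ where
    (inj₁ (inj₁ j+1≡i))         → ℕ.<-asym i<j (ℕ.≤-reflexive j+1≡i)
    (inj₁ (inj₂ (j+1≡n , i≡0))) →
      [ (λ 0<i → ℕ.<⇒≢ 0<i (sym i≡0)) , (λ j+1<n → ℕ.<⇒≢ j+1<n j+1≡n) ] end
    (inj₂ (inj₁ i+1≡j))         → ℕ.1+n≰n (subst (2 + toℕ i ≤_) (sym i+1≡j) i+2≤j)
    (inj₂ (inj₂ (_ , j≡0)))     → contradiction (subst (2 + toℕ i ≤_) j≡0 i+2≤j) λ ()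
  where
  i<j : toℕ i < toℕ j
  i<j = ℕ.≤-trans (ℕ.n≤1+n _) i+2≤j
  j≢i : j ≢ i
  j≢i refl = ℕ.<-irrefl refl i<j

firstTwo : Subset (2 + n)
firstTwo = inside ∷ inside ∷ ⊥

suc-suc-∉firstTwo : (x : Fin n) → suc (suc x) ∉ firstTwo
suc-suc-∉firstTwo x (there (there x∈⊥)) = ∉⊥ x∈⊥

firstTwo-restrainedDominating : ∀ m → IsRestrainedDominating (complement (cycle (6 + m))) firstTwo
firstTwo-restrainedDominating m zero v∉ = contradiction here v∉
firstTwo-restrainedDominating m (suc zero) v∉ = contradiction (there here) v∉
firstTwo-restrainedDominating m (suc (suc zero)) _ =
  (# 0 , here , apart⇒adjacent ℕ.≤-refl (inj₂ (ℕ.m≤m+n 4 (2 + m))))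
  , (# 4 , suc-suc-∉firstTwo _ , complement-cycle-sym (apart⇒adjacent ℕ.≤-refl (inj₁ ℕ.z<s)))
firstTwo-restrainedDominating m (suc (suc (suc w))) _ =
  (# 1 , there here , apart⇒adjacent (ℕ.m≤m+n 3 (toℕ w)) (inj₁ ℕ.z<s)) , outsideNeighbour w
  where
  outsideNeighbour : (w : Fin (3 + m)) →
                     ∃ λ u → u ∉ firstTwo × complement (cycle (6 + m)) (suc (suc (suc w))) u
  outsideNeighbour zero    =
    # 5 , suc-suc-∉firstTwo _ , complement-cycle-sym (apart⇒adjacent ℕ.≤-refl (inj₁ ℕ.z<s))
  outsideNeighbour (suc w) =
    # 2 , suc-suc-∉firstTwo _ , apart⇒adjacent (ℕ.m≤m+n 4 (toℕ w)) (inj₁ ℕ.z<s)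

γʳ-complement-C₆₊ : ∀ m → RestrainedDominationNumber (complement (cycle (6 + m))) 2
γʳ-complement-C₆₊ m =
  (firstTwo , firstTwo-restrainedDominating m , cong (2 +_) (∣⊥∣≡0 (4 + m)))
  , λ S rds → restrainedDominating-≥2 complement-cycle-nonNeighbour rds zero

-- The complement of C₄ is a perfect matching, so no vertex outside S can
-- have neighbours both in and outside S.
γʳ-complement-C₄ : RestrainedDominationNumber (complement (cycle 4)) 4
γʳ-complement-C₄ =
  (⊤ , from-yes (isRestrainedDominating? (complement? (cycle? 4)) ⊤) , refl)
  , from-yes (isRestrainedLowerBound? (complement? (cycle? 4)) 4)

γʳ-complement-C₅ : RestrainedDominationNumber (complement (cycle 5)) 3
γʳ-complement-C₅ =
  (S₀₁₃ , from-yes (isRestrainedDominating? (complement? (cycle? 5)) S₀₁₃) , refl)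
  , from-yes (isRestrainedLowerBound? (complement? (cycle? 5)) 3)
  where
  S₀₁₃ : Subset 5
  S₀₁₃ = inside ∷ inside ∷ outside ∷ inside ∷ outside ∷ []

proposition2p4 : (n : ℕ) → n ≥ 4 →
    (n ≡ 4 → RestrainedDominationNumber (complement (cycle n)) 4)
    × (n ≡ 5 → RestrainedDominationNumber (complement (cycle n)) 3)
    × (¬ n ≡ 4 → ¬ n ≡ 5 → RestrainedDominationNumber (complement (cycle n)) 2)
proposition2p4 4 _ = (λ _ → γʳ-complement-C₄) , (λ ()) , λ 4≢4 _ → contradiction refl 4≢4
proposition2p4 5 _ = (λ ()) , (λ _ → γʳ-complement-C₅) , λ _ 5≢5 → contradiction refl 5≢5
proposition2p4 (ℕ.suc (ℕ.suc (ℕ.suc (ℕ.suc (ℕ.suc (ℕ.suc m)))))) _ =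
  (λ ()) , (λ ()) , λ _ _ → γʳ-complement-C₆₊ m
proposition2p4 0 ()
proposition2p4 1 (s≤s ())
proposition2p4 2 (s≤s (s≤s ()))
proposition2p4 3 (s≤s (s≤s (s≤s ())))
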